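{- For every positive integer $k$, there is a graph $G_k$ that is a union of cycles sharing a single common vertex (and otherwise pairwise vertex-disjoint) such that $z(G_k)\geq k$.
   Context: The game of Zombies and Survivor on a finite connected graph: first a set of zombies is placed on vertices, then a single survivor chooses a vertex. Then the players alternate rounds: each zombie moves along an edge following some shortest path (geodesic) from its current position to the survivor, so each zombie's distance to the survivor decreases by one (if several shortest paths exist, the zombies may choose which one to follow — the deterministic version); then the survivor moves to an adjacent vertex or stays put. The zombies win if some zombie moves onto the vertex of the survivor. The zombie number $z(G)$ is the minimum number of zombies such that the zombies have a strategy guaranteeing capture of the survivor in finite time regardless of how the survivor plays. -}

module Defs where

open import Data.Nat using (ℕ; zero; suc; _≤_; _∸_)
open import Data.Fin using (Fin; toℕ)
open import Data.Product using (Σ; ∃; ∃-syntax; _×_; _,_)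
open import Data.Sum using (_⊎_)
open import Relation.Binary.PropositionalEquality using (_≡_)
open import Relation.Nullary using (¬_)

module Game {V : Set} (Adj : V → V → Set) where

  data Walk (u : V) : V → ℕ → Set where
    here : Walk u u 0
    step : ∀ {w v n} → Adj u w → Walk w v n → Walk u v (suc n)

  Dist : V → V → ℕ → Set
  Dist u v d = Walk u v d × (∀ m → Walk u v m → d ≤ m)

  ZombieStep : V → V → V → Set
  ZombieStep s z z' = Adj z z' × ∃[ d ] (Dist z s (suc d) × Dist z' s d)

  SurvStep : V → V → Set
  SurvStep s s' = s ≡ s' ⊎ Adj s s'

  Caught : ∀ {m} → (Fin m → V) → V → Set
  Caught zs s = ∃[ i ] (zs i ≡ s)

  -- ZWin zs s : from the position (zombies at zs, survivor at s, zombies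
  -- to move), the zombies can force capture in finitely many rounds.
  -- (Inductive, i.e. well-founded: every play is finite.)
  data ZWin {m : ℕ} (zs : Fin m → V) (s : V) : Set where
    caught : Caught zs s → ZWin zs s
    move   : (zs' : Fin m → V)
           → (∀ i → ZombieStep s (zs i) (zs' i))
           → (Caught zs' s ⊎ (∀ s' → SurvStep s s' → ZWin zs' s'))
           → ZWin zs s

  ZombiesWin : ℕ → Set
  ZombiesWin m = Σ (Fin m → V) λ zs → ∀ s → ZWin zs s

  -- z(G) ≥ k : no fewer than k zombies can win
  -- (z(G) is the least m with ZombiesWin m).
  ZombieNumber≥ : ℕ → Set
  ZombieNumber≥ k = ∀ m → suc m ≤ k → ¬ ZombiesWin m

-- Cycle i is  centre – pt i 0 – pt i 1 – … – pt i (ℓ i - 2) – centre.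

data BVert {r : ℕ} (ℓ : Fin r → ℕ) : Set where
  centre : BVert ℓ
  pt     : (i : Fin r) → Fin (ℓ i ∸ 1) → BVert ℓ

data BEdge {r : ℕ} (ℓ : Fin r → ℕ) : BVert ℓ → BVert ℓ → Set where
  first : ∀ i (j : Fin (ℓ i ∸ 1)) → toℕ j ≡ 0 → BEdge ℓ centre (pt i j)
  last  : ∀ i (j : Fin (ℓ i ∸ 1)) → toℕ j ≡ ℓ i ∸ 2 → BEdge ℓ (pt i j) centre
  next  : ∀ i (j j' : Fin (ℓ i ∸ 1)) → toℕ j' ≡ suc (toℕ j) → BEdge ℓ (pt i j) (pt i j')

BAdj : ∀ {r} (ℓ : Fin r → ℕ) → BVert ℓ → BVert ℓ → Set
BAdj ℓ u v = BEdge ℓ u v ⊎ BEdge ℓ v u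

module Submission where

-- The bouquet has k copies of each of k classes of odd cycles, class a of length 2 h + 1 with
-- h = 3^(a+1). Against m < k zombies the survivor picks a class a whose "window"
-- [h − 2, 2 h] contains no zombie's distance to the centre (windows of different classes are
-- disjoint), a zombie-free copy A of class a and a zombie-free copy B of the largest class.
-- It starts two steps into A, walks once around A and then around B forever. A zombie on any
-- other cycle walks to the centre and, thanks to the window, gets there while the survivor is
-- between 2 and h steps into its current cycle. From then on it trails the survivor along its
-- route at a gap g with 2 ≤ g < h; on a cycle of length 2 h + 1 the geodesic from such a zombie
-- to the survivor is unique and follows the route, so the gap never closes.

open import Defs
open import Data.Nat using (ℕ; zero; suc; pred; _+_; _*_; _∸_; _^_; _≤_; _<_; z≤n; s≤s; _⊓_; ∣_-_∣; _≤?_; _<?_)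
open import Data.Nat.Properties renaming (_≟_ to _≟ℕ_)
open import Data.Fin using (Fin; toℕ; fromℕ; fromℕ<; _≟_; combine; remQuot)
open import Data.Fin.Properties
  using (toℕ<n; toℕ-fromℕ; toℕ-fromℕ<; fromℕ<-toℕ; toℕ-injective; remQuot-combine; combine-injectiveˡ; any?; all?; ¬∀⟶∃¬; pigeonhole)
open import Relation.Nullary.Decidable using (¬?; _×-dec_; decidable-stable)
open import Relation.Binary.Definitions using (tri<; tri≈; tri>)
open import Data.Product using (Σ; _×_; _,_; proj₁; proj₂)
open import Function using (_∘_)
open import Data.Sum using (_⊎_; inj₁; inj₂)
import Data.Sum
open import Data.Empty using (⊥; ⊥-elim)
open import Relation.Nullary using (¬_; Dec; yes; no)
open import Relation.Binary.PropositionalEquality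

m∸n≤1+m∸1+n : ∀ m n → m ∸ n ≤ suc (m ∸ suc n)
m∸n≤1+m∸1+n zero    n       rewrite 0∸n≡0 n = z≤n
m∸n≤1+m∸1+n (suc m) zero    = ≤-refl
m∸n≤1+m∸1+n (suc m) (suc n) = m∸n≤1+m∸1+n m n

∣1+m-n∣≤1+∣m-n∣ : ∀ m n → ∣ suc m - n ∣ ≤ suc ∣ m - n ∣
∣1+m-n∣≤1+∣m-n∣ zero    zero    = s≤s z≤n
∣1+m-n∣≤1+∣m-n∣ (suc m) zero    = ≤-refl
∣1+m-n∣≤1+∣m-n∣ zero    (suc n) = ≤-trans (n≤1+n n) (n≤1+n (suc n))
∣1+m-n∣≤1+∣m-n∣ (suc m) (suc n) = ∣1+m-n∣≤1+∣m-n∣ m n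

∣m-n∣≤1+∣1+m-n∣ : ∀ m n → ∣ m - n ∣ ≤ suc ∣ suc m - n ∣
∣m-n∣≤1+∣1+m-n∣ zero    zero          = z≤n
∣m-n∣≤1+∣1+m-n∣ (suc m) zero          = ≤-trans (n≤1+n (suc m)) (n≤1+n (suc (suc m)))
∣m-n∣≤1+∣1+m-n∣ zero    (suc zero)    = s≤s z≤n
∣m-n∣≤1+∣1+m-n∣ zero    (suc (suc n)) = ≤-refl
∣m-n∣≤1+∣1+m-n∣ (suc m) (suc n)       = ∣m-n∣≤1+∣1+m-n∣ m n

m∸[n∸o]≡m∸n+o : ∀ {m n o} → o ≤ n → n ≤ m → m ∸ (n ∸ o) ≡ m ∸ n + o
m∸[n∸o]≡m∸n+o {m} {n} {zero} _ _ = sym (+-identityʳ (m ∸ n))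
m∸[n∸o]≡m∸n+o {suc m} {suc n} {suc o} (s≤s o≤n) (s≤s n≤m) = begin
  suc m ∸ (n ∸ o)     ≡⟨ +-∸-assoc 1 (≤-trans (m∸n≤m n o) n≤m) ⟩
  suc (m ∸ (n ∸ o))   ≡⟨ cong suc (m∸[n∸o]≡m∸n+o o≤n n≤m) ⟩
  suc (m ∸ n + o)     ≡⟨ sym (+-suc (m ∸ n) o) ⟩
  m ∸ n + suc o       ∎
  where open ≡-Reasoning

<-excludes-≥ : ∀ {m n} {Q : Set} → m < n → n ≤ m ⊎ Q → Q
<-excludes-≥ m<n (inj₁ n≤m) = ⊥-elim (<-irrefl refl (<-≤-trans m<n n≤m))
<-excludes-≥ m<n (inj₂ q)   = q

free-slot : ∀ {m k} → m < k → (Blocks : Fin k → Fin m → Set) → (∀ c i → Dec (Blocks c i)) →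
            (∀ {c c' i} → Blocks c i → Blocks c' i → c ≡ c') → Σ (Fin k) λ c → ∀ i → ¬ Blocks c i
free-slot {m} {k} m<k Blocks blocks? unique with any? (λ c → all? (λ i → ¬? (blocks? c i)))
... | yes free = free
... | no  none =
  let c , c' , c<c' , same = pigeonhole m<k (proj₁ ∘ blocker)
  in  ⊥-elim (<-irrefl (cong toℕ (unique (proj₂ (blocker c)) (subst (Blocks c') (sym same) (proj₂ (blocker c'))))) c<c')
  where
  blocker : ∀ c → Σ (Fin m) (Blocks c)
  blocker c with ¬∀⟶∃¬ m (λ i → ¬ Blocks c i) (λ i → ¬? (blocks? c i)) (λ free → none (c , free))
  ... | i , ¬¬blocks = i , decidable-stable (blocks? c i) ¬¬blocks

module GameProperties {V : Set} (Adj : V → V → Set) where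
  open Game Adj

  _++ʷ_ : ∀ {u v w a b} → Walk u v a → Walk v w b → Walk u w (a + b)
  here ++ʷ q = q
  step e p ++ʷ q = step e (p ++ʷ q)

  zombieStep-forced : ∀ {s z z' e N} → Walk z s N →
                      (∀ w → Adj z w → w ≡ e ⊎ (∀ n → Walk w s n → N ≤ n)) →
                      ZombieStep s z z' → z' ≡ e
  zombieStep-forced W others (adj , d , (_ , minimal) , (W' , _)) with others _ adj
  ... | inj₁ z'≡e = z'≡e
  ... | inj₂ far = ⊥-elim (1+n≰n (≤-trans (minimal _ W) (far d W')))

  module Evasion {S : Set} (at : S → V) (advance : S → S) (Valid : S → Set) (Safe : V → S → Set)
                 (valid-advance : ∀ {σ} → Valid σ → Valid (advance σ))
                 (moves : ∀ {σ} → Valid σ → Adj (at σ) (at (advance σ)))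
                 (apart : ∀ {z σ} → Valid σ → Safe z σ → z ≢ at σ)
                 (stays : ∀ {z z' σ} → Valid σ → Safe z σ → ZombieStep (at σ) z z' →
                          z' ≢ at σ × Safe z' (advance σ))
                 where

    survivor-evades : ∀ {m} {zs : Fin m → V} {σ} → Valid σ → (∀ i → Safe (zs i) σ) → ¬ ZWin zs (at σ)
    survivor-evades valid safe (caught (i , zᵢ≡s)) = apart valid (safe i) zᵢ≡s
    survivor-evades valid safe (move zs' steps (inj₁ (i , zᵢ≡s))) = proj₁ (stays valid (safe i) (steps i)) zᵢ≡s
    survivor-evades {σ = σ} valid safe (move zs' steps (inj₂ continue)) =
      survivor-evades (valid-advance valid) (λ i → proj₂ (stays valid (safe i) (steps i)))
                      (continue (at (advance σ)) (inj₂ (moves valid)))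

cycleDist : ℕ → ℕ → ℕ
cycleDist L a = a ⊓ (L ∸ a)

cycleDist-≤-suc : ∀ L {a b} → a ≤ suc b → b ≤ suc a → cycleDist L a ≤ suc (cycleDist L b)
cycleDist-≤-suc L {a} a≤1+b b≤1+a =
  ⊓-mono-≤ a≤1+b (≤-trans (m∸n≤1+m∸1+n L a) (s≤s (∸-monoʳ-≤ L b≤1+a)))

cycleDist-∣1+m-n∣ : ∀ L m n → cycleDist L ∣ suc m - n ∣ ≤ suc (cycleDist L ∣ m - n ∣)
cycleDist-∣1+m-n∣ L m n = cycleDist-≤-suc L (∣1+m-n∣≤1+∣m-n∣ m n) (∣m-n∣≤1+∣1+m-n∣ m n)

cycleDist-∣m-n∣ : ∀ L m n → cycleDist L ∣ m - n ∣ ≤ suc (cycleDist L ∣ suc m - n ∣)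
cycleDist-∣m-n∣ L m n = cycleDist-≤-suc L (∣m-n∣≤1+∣1+m-n∣ m n) (∣1+m-n∣≤1+∣m-n∣ m n)

cycleDist-reflect : ∀ L {a} → a ≤ L → cycleDist L (L ∸ a) ≡ cycleDist L a
cycleDist-reflect L {a} a≤L = trans (cong ((L ∸ a) ⊓_) (m∸[m∸n]≡n a≤L)) (⊓-comm (L ∸ a) a)

cycleDist-1 : ∀ L → cycleDist L 1 ≤ 1
cycleDist-1 L = m⊓n≤m 1 _

cycleDist-end : ∀ L {a} → a ≡ 0 ⊎ a ≡ L → cycleDist L a ≡ 0
cycleDist-end L (inj₁ refl) = refl
cycleDist-end L (inj₂ refl) = trans (cong (L ⊓_) (n∸n≡0 L)) (⊓-zeroʳ L)

cycleDist-∣end-n∣ : ∀ L {a} n → a ≡ 0 ⊎ a ≡ L → n ≤ L → cycleDist L ∣ a - n ∣ ≡ cycleDist L n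
cycleDist-∣end-n∣ L n (inj₁ refl) _   = refl
cycleDist-∣end-n∣ L n (inj₂ refl) n≤L =
  trans (cong (cycleDist L) (m≤n⇒∣n-m∣≡n∸m n≤L)) (cycleDist-reflect L n≤L)

cycleDist-pos : ∀ L {a} → 1 ≤ a → a < L → 1 ≤ cycleDist L a
cycleDist-pos L 1≤a a<L = ⊓-glb 1≤a (m<n⇒0<n∸m a<L)

cycleDist-L∸1 : ∀ L → 1 ≤ L → cycleDist L (L ∸ 1) ≤ 1
cycleDist-L∸1 L 1≤L = ≤-trans (≤-reflexive (cycleDist-reflect L 1≤L)) (cycleDist-1 L)

cycleDist-∣L∸1-n∣ : ∀ L m n → m ≡ L ∸ 1 → n ≤ L →
                    cycleDist L ∣ m - n ∣ ≤ suc (cycleDist L n) × cycleDist L n ≤ suc (cycleDist L ∣ m - n ∣)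
cycleDist-∣L∸1-n∣ zero    _ _ refl z≤n = z≤n , z≤n
cycleDist-∣L∸1-n∣ (suc L) _ n refl n≤1+L rewrite sym (cycleDist-∣end-n∣ (suc L) n (inj₂ refl) n≤1+L) =
  cycleDist-∣m-n∣ (suc L) L n , cycleDist-∣1+m-n∣ (suc L) L n

module OddCycle (H : ℕ) where

  L : ℕ
  L = suc (H + H)

  cycleDist-≤half : ∀ {a} → a ≤ H → cycleDist L a ≡ a
  cycleDist-≤half {a} a≤H = m≤n⇒m⊓n≡m (m+n≤o⇒m≤o∸n a (≤-trans (+-mono-≤ a≤H a≤H) (n≤1+n (H + H))))

  L∸>half : ∀ {a} → H < a → L ∸ a ≤ H
  L∸>half H<a = ≤-trans (∸-monoʳ-≤ L H<a) (≤-reflexive (m+n∸n≡m H H))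

  cycleDist-reflect-≤half : ∀ {a} → a ≤ H → cycleDist L (L ∸ a) ≡ a
  cycleDist-reflect-≤half a≤H =
    trans (cycleDist-reflect L (≤-trans a≤H (≤-trans (m≤m+n H H) (n≤1+n (H + H))))) (cycleDist-≤half a≤H)

  cycleDist->half : ∀ {a} → H < a → a ≤ L → cycleDist L a ≡ L ∸ a
  cycleDist->half {a} H<a a≤L =
    subst (λ b → cycleDist L b ≡ L ∸ a) (m∸[m∸n]≡n a≤L) (cycleDist-reflect-≤half (L∸>half H<a))

  cycleDist-≤-H : ∀ a → cycleDist L a ≤ H
  cycleDist-≤-H a with a ≤? H
  ... | yes a≤H = ≤-trans (m⊓n≤m a _) a≤H
  ... | no  a≰H = ≤-trans (m⊓n≤n a _) (L∸>half (≰⇒> a≰H))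

  ≤half⇒≤cycleDist-suc : ∀ {a} → a ≤ H → a ≤ cycleDist L (suc a)
  ≤half⇒≤cycleDist-suc {a} a≤H =
    ⊓-glb (n≤1+n a) (≤-trans a≤H (≤-trans (≤-reflexive (sym (m+n∸n≡m H H))) (∸-monoʳ-≤ (H + H) a≤H)))

  >half⇒≤cycleDist-pred : ∀ {a} → H < a → L ∸ a ≤ cycleDist L (pred a)
  >half⇒≤cycleDist-pred {suc a} H<1+a = ⊓-glb (≤-trans (L∸>half H<1+a) (≤-pred H<1+a)) (∸-monoʳ-≤ L (n≤1+n a))

suc-toℕ< : ∀ L (q : Fin (L ∸ 1)) → suc (toℕ q) < L
suc-toℕ< (suc L) q = s≤s (toℕ<n q)

last-toℕ : ∀ L (q : Fin (L ∸ 1)) → toℕ q ≡ L ∸ 2 → suc (toℕ q) ≡ L ∸ 1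
last-toℕ (suc (suc L)) q e = cong suc e

module Bouquet {r : ℕ} (ℓ : Fin r → ℕ) where
  open Game (BAdj ℓ)
  open GameProperties (BAdj ℓ)

  BAdj-sym : ∀ {x y} → BAdj ℓ x y → BAdj ℓ y x
  BAdj-sym (inj₁ e) = inj₂ e
  BAdj-sym (inj₂ e) = inj₁ e

  -- pt i q lies at position 1 + toℕ q along cycle i.
  dist : BVert ℓ → BVert ℓ → ℕ
  dist centre   centre   = 0
  dist centre   (pt i q) = cycleDist (ℓ i) (suc (toℕ q))
  dist (pt j p) centre   = cycleDist (ℓ j) (suc (toℕ p))
  dist (pt j p) (pt i q) with j ≟ i
  ... | yes _ = cycleDist (ℓ i) ∣ suc (toℕ p) - suc (toℕ q) ∣
  ... | no  _ = cycleDist (ℓ j) (suc (toℕ p)) + cycleDist (ℓ i) (suc (toℕ q))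

  dist-self : ∀ v → dist v v ≡ 0
  dist-self centre = refl
  dist-self (pt i q) with i ≟ i
  ... | yes _   = cong (cycleDist (ℓ i)) (∣n-n∣≡0 (toℕ q))
  ... | no  i≢i = ⊥-elim (i≢i refl)

  edge-dist : ∀ {x y} → BEdge ℓ x y → ∀ s → dist x s ≤ suc (dist y s) × dist y s ≤ suc (dist x s)
  edge-dist (first i q e) centre rewrite e = z≤n , cycleDist-1 (ℓ i)
  edge-dist (first i q e) (pt i' q') with i ≟ i'
  ... | yes refl rewrite e = cycleDist-∣m-n∣ (ℓ i) 0 (suc (toℕ q')) , cycleDist-∣1+m-n∣ (ℓ i) 0 (suc (toℕ q'))
  ... | no  _    rewrite e = ≤-trans (m≤n+m _ _) (n≤1+n _) , +-monoˡ-≤ _ (cycleDist-1 (ℓ i))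
  edge-dist (last i q e) centre rewrite last-toℕ (ℓ i) q e =
    cycleDist-L∸1 (ℓ i) (≤-<-trans z≤n (suc-toℕ< (ℓ i) q)) , z≤n
  edge-dist (last i q e) (pt i' q') with i ≟ i'
  ... | yes refl =
    cycleDist-∣L∸1-n∣ (ℓ i) (suc (toℕ q)) (suc (toℕ q')) (last-toℕ (ℓ i) q e) (<⇒≤ (suc-toℕ< (ℓ i) q'))
  ... | no  _    rewrite last-toℕ (ℓ i) q e =
    +-monoˡ-≤ _ (cycleDist-L∸1 (ℓ i) (≤-<-trans z≤n (suc-toℕ< (ℓ i) q))) , ≤-trans (m≤n+m _ _) (n≤1+n _)
  edge-dist (next i q q' e) centre rewrite e =
    cycleDist-≤-suc (ℓ i) (≤-trans (n≤1+n _) (n≤1+n _)) ≤-refl ,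
    cycleDist-≤-suc (ℓ i) ≤-refl (≤-trans (n≤1+n _) (n≤1+n _))
  edge-dist (next i q q' e) (pt i' q'') with i ≟ i'
  ... | yes refl rewrite e = cycleDist-∣m-n∣ (ℓ i) (toℕ q) (toℕ q'') , cycleDist-∣1+m-n∣ (ℓ i) (toℕ q) (toℕ q'')
  ... | no  _    rewrite e =
    +-monoˡ-≤ _ (cycleDist-≤-suc (ℓ i) (≤-trans (n≤1+n _) (n≤1+n _)) ≤-refl) ,
    +-monoˡ-≤ _ (cycleDist-≤-suc (ℓ i) ≤-refl (≤-trans (n≤1+n _) (n≤1+n _)))

  adj-dist-≤ : ∀ {x y} → BAdj ℓ x y → ∀ s → dist x s ≤ suc (dist y s)
  adj-dist-≤ (inj₁ e) s = proj₁ (edge-dist e s)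
  adj-dist-≤ (inj₂ e) s = proj₂ (edge-dist e s)

  walk-dist-≤ : ∀ {u v n} → Walk u v n → ∀ s → dist u s ≤ n + dist v s
  walk-dist-≤ here       s = ≤-refl
  walk-dist-≤ (step a w) s = ≤-trans (adj-dist-≤ a s) (s≤s (walk-dist-≤ w s))

  walk⇒dist≤ : ∀ {u v n} → Walk u v n → dist u v ≤ n
  walk⇒dist≤ {v = v} {n} w = ≤-trans (walk-dist-≤ w v) (≤-reflexive (trans (cong (n +_) (dist-self v)) (+-identityʳ n)))

  dist-pos⇒≢ : ∀ {z s} → 1 ≤ dist z s → z ≢ s
  dist-pos⇒≢ {s = s} 1≤d refl = <-irrefl (sym (dist-self s)) 1≤d

  zombieStep-forced-by-dist : ∀ {s z z' e N} → Walk z s N → (∀ w → BAdj ℓ z w → w ≡ e ⊎ N ≤ dist w s) →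
                              ZombieStep s z z' → z' ≡ e
  zombieStep-forced-by-dist W others =
    zombieStep-forced W λ w adj → Data.Sum.map₂ (λ N≤d n W' → ≤-trans N≤d (walk⇒dist≤ W')) (others w adj)

  -- Positions 0 and ℓ j (and, as junk, anything beyond ℓ j) are the centre.
  onCycle : Fin r → ℕ → BVert ℓ
  onCycle j zero = centre
  onCycle j (suc y) with y <? ℓ j ∸ 1
  ... | yes y< = pt j (fromℕ< y<)
  ... | no  _  = centre

  onCycle-pt : ∀ j (q : Fin (ℓ j ∸ 1)) → onCycle j (suc (toℕ q)) ≡ pt j q
  onCycle-pt j q with toℕ q <? ℓ j ∸ 1
  ... | yes q< = cong (pt j) (fromℕ<-toℕ q q<)
  ... | no  q≮ = ⊥-elim (q≮ (toℕ<n q))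

  onCycle-end : ∀ j {Y} → Y ≡ ℓ j → onCycle j Y ≡ centre
  onCycle-end j {zero}  _ = refl
  onCycle-end j {suc y} e with y <? ℓ j ∸ 1
  ... | yes y< = ⊥-elim (<-irrefl refl (subst (λ L → y < L ∸ 1) (sym e) y<))
  ... | no  _  = refl

  OnCycleView : Fin r → ℕ → Set
  OnCycleView j Y = (onCycle j Y ≡ centre × (Y ≡ 0 ⊎ Y ≡ ℓ j))
                  ⊎ Σ (Fin (ℓ j ∸ 1)) λ q → onCycle j Y ≡ pt j q × Y ≡ suc (toℕ q)

  onCycle-view : ∀ j Y → Y ≤ ℓ j → OnCycleView j Y
  onCycle-view j zero    _ = inj₁ (refl , inj₁ refl)
  onCycle-view j (suc y) Y≤ℓ with y <? ℓ j ∸ 1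
  ... | yes y< = inj₂ (fromℕ< y< , refl , cong suc (sym (toℕ-fromℕ< y<)))
  ... | no  y≮ = inj₁ (refl , inj₂ (≤-antisym Y≤ℓ (≮⇒≥ λ Y<ℓ → y≮ (∸-monoˡ-< Y<ℓ (s≤s z≤n)))))

  onCycle-adj : ∀ j Y → 2 ≤ ℓ j → suc Y ≤ ℓ j → BAdj ℓ (onCycle j Y) (onCycle j (suc Y))
  onCycle-adj j zero 2≤ℓ _ with 0 <? ℓ j ∸ 1
  ... | yes 0< = inj₁ (first j (fromℕ< 0<) (toℕ-fromℕ< 0<))
  ... | no  0≮ = ⊥-elim (0≮ (∸-monoˡ-≤ 1 2≤ℓ))
  onCycle-adj j (suc y) _ 2+y≤ℓ with y <? ℓ j ∸ 1 | suc y <? ℓ j ∸ 1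
  ... | yes y< | yes 1+y< =
    inj₁ (next j (fromℕ< y<) (fromℕ< 1+y<) (trans (toℕ-fromℕ< 1+y<) (cong suc (sym (toℕ-fromℕ< y<)))))
  ... | yes y< | no  1+y≮ = inj₁ (last j (fromℕ< y<) (trans (toℕ-fromℕ< y<) y≡ℓ∸2))
    where
    y≡ℓ∸2 : y ≡ ℓ j ∸ 2
    y≡ℓ∸2 = trans (cong pred (≤-antisym (∸-monoˡ-≤ 1 2+y≤ℓ) (≮⇒≥ 1+y≮)))
                  (pred[m∸n]≡m∸[1+n] (ℓ j) 1)
  ... | no  y≮ | _ = ⊥-elim (y≮ (∸-monoˡ-≤ 1 2+y≤ℓ))

  pt-neighbours : ∀ {w} j (q : Fin (ℓ j ∸ 1)) → BAdj ℓ (pt j q) w →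
                  w ≡ onCycle j (toℕ q) ⊎ w ≡ onCycle j (suc (suc (toℕ q)))
  pt-neighbours j q (inj₁ (last .j .q e)) =
    inj₂ (sym (onCycle-end j (trans (cong suc (last-toℕ (ℓ j) q e))
                                    (m+[n∸m]≡n (≤-<-trans z≤n (suc-toℕ< (ℓ j) q))))))
  pt-neighbours j q (inj₁ (next .j .q q' e)) = inj₂ (trans (sym (onCycle-pt j q')) (cong (onCycle j) (cong suc e)))
  pt-neighbours j q (inj₂ (first .j .q e))   = inj₁ (cong (onCycle j) (sym e))
  pt-neighbours j q (inj₂ (next .j q' .q e)) = inj₁ (trans (sym (onCycle-pt j q')) (cong (onCycle j) (sym e)))

  onCycle-neighbours : ∀ {w} j {Y} → 1 ≤ Y → Y < ℓ j → BAdj ℓ (onCycle j Y) w →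
                       w ≡ onCycle j (pred Y) ⊎ w ≡ onCycle j (suc Y)
  onCycle-neighbours j {Y} 1≤Y Y<ℓ adj with onCycle-view j Y (<⇒≤ Y<ℓ)
  ... | inj₁ (_ , inj₁ refl) = ⊥-elim (<-irrefl refl 1≤Y)
  ... | inj₁ (_ , inj₂ refl) = ⊥-elim (<-irrefl refl Y<ℓ)
  ... | inj₂ (q , e , refl)  = pt-neighbours j q (subst (λ v → BAdj ℓ v _) e adj)

  centre-neighbours : ∀ {w} → BAdj ℓ centre w → Σ (Fin r) λ j → w ≡ onCycle j 1 ⊎ w ≡ onCycle j (ℓ j ∸ 1)
  centre-neighbours (inj₁ (first j q e)) = j , inj₁ (trans (sym (onCycle-pt j q)) (cong (λ y → onCycle j (suc y)) e))
  centre-neighbours (inj₂ (last j q e))  = j , inj₂ (trans (sym (onCycle-pt j q)) (cong (onCycle j) (last-toℕ (ℓ j) q e)))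

  dist-onCycle-≢ : ∀ {j i} → j ≢ i → ∀ Y Q → Y ≤ ℓ j → Q ≤ ℓ i →
                   dist (onCycle j Y) (onCycle i Q) ≡ cycleDist (ℓ j) Y + cycleDist (ℓ i) Q
  dist-onCycle-≢ {j} {i} j≢i Y Q Y≤ Q≤ with onCycle-view j Y Y≤ | onCycle-view i Q Q≤
  ... | inj₁ (eY , endY) | inj₁ (eQ , endQ) rewrite eY | eQ =
    sym (cong₂ _+_ (cycleDist-end (ℓ j) endY) (cycleDist-end (ℓ i) endQ))
  ... | inj₁ (eY , endY) | inj₂ (q , eQ , refl) rewrite eY | eQ =
    sym (cong (_+ cycleDist (ℓ i) (suc (toℕ q))) (cycleDist-end (ℓ j) endY))
  ... | inj₂ (p , eY , refl) | inj₁ (eQ , endQ) rewrite eY | eQ =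
    sym (trans (cong (cycleDist (ℓ j) (suc (toℕ p)) +_) (cycleDist-end (ℓ i) endQ)) (+-identityʳ _))
  ... | inj₂ (p , eY , refl) | inj₂ (q , eQ , refl) rewrite eY | eQ with j ≟ i
  ...   | yes j≡i = ⊥-elim (j≢i j≡i)
  ...   | no  _   = refl

  dist-onCycle : ∀ i Y Q → Y ≤ ℓ i → Q ≤ ℓ i → dist (onCycle i Y) (onCycle i Q) ≡ cycleDist (ℓ i) ∣ Y - Q ∣
  dist-onCycle i Y Q Y≤ Q≤ with onCycle-view i Y Y≤ | onCycle-view i Q Q≤
  ... | inj₁ (eY , endY) | inj₁ (eQ , endQ) rewrite eY | eQ =
    sym (trans (cycleDist-∣end-n∣ (ℓ i) Q endY Q≤) (cycleDist-end (ℓ i) endQ))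
  ... | inj₁ (eY , endY) | inj₂ (q , eQ , refl) rewrite eY | eQ = sym (cycleDist-∣end-n∣ (ℓ i) _ endY Q≤)
  ... | inj₂ (p , eY , refl) | inj₁ (eQ , endQ) rewrite eY | eQ =
    sym (trans (cong (cycleDist (ℓ i)) (∣-∣-comm Y Q)) (cycleDist-∣end-n∣ (ℓ i) _ endQ Y≤))
  ... | inj₂ (p , eY , refl) | inj₂ (q , eQ , refl) rewrite eY | eQ with i ≟ i
  ...   | yes _   = refl
  ...   | no  i≢i = ⊥-elim (i≢i refl)

  onCycle-walk-up : ∀ j n Y → 2 ≤ ℓ j → n + Y ≤ ℓ j → Walk (onCycle j Y) (onCycle j (n + Y)) n
  onCycle-walk-up j zero    Y _   _ = here
  onCycle-walk-up j (suc n) Y 2≤ℓ ≤ℓ =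
    step (onCycle-adj j Y 2≤ℓ (≤-trans (s≤s (m≤n+m Y n)) ≤ℓ))
         (subst (λ X → Walk (onCycle j (suc Y)) (onCycle j X) n) (+-suc n Y)
                (onCycle-walk-up j n (suc Y) 2≤ℓ (subst (_≤ ℓ j) (sym (+-suc n Y)) ≤ℓ)))

  onCycle-walk-down : ∀ j n Y → 2 ≤ ℓ j → n + Y ≤ ℓ j → Walk (onCycle j (n + Y)) (onCycle j Y) n
  onCycle-walk-down j zero    Y _   _ = here
  onCycle-walk-down j (suc n) Y 2≤ℓ ≤ℓ =
    step (BAdj-sym (onCycle-adj j (n + Y) 2≤ℓ ≤ℓ)) (onCycle-walk-down j n Y 2≤ℓ (≤-trans (n≤1+n _) ≤ℓ))

  centre-walk : ∀ j {X} → 2 ≤ ℓ j → X ≤ ℓ j → Walk centre (onCycle j X) (cycleDist (ℓ j) X)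
  centre-walk j {X} 2≤ℓ X≤ℓ with ⊓-sel X (ℓ j ∸ X)
  ... | inj₁ e = subst (Walk centre (onCycle j X)) (sym e)
                   (subst (λ Y → Walk centre (onCycle j Y) X) (+-identityʳ X)
                     (onCycle-walk-up j X 0 2≤ℓ (subst (_≤ ℓ j) (sym (+-identityʳ X)) X≤ℓ)))
  ... | inj₂ e = subst (Walk centre (onCycle j X)) (sym e)
                   (subst (λ v → Walk v (onCycle j X) (ℓ j ∸ X)) (onCycle-end j (m∸n+n≡m X≤ℓ))
                     (onCycle-walk-down j (ℓ j ∸ X) X 2≤ℓ (≤-reflexive (m∸n+n≡m X≤ℓ))))

  walk-to-centre : ∀ j {X} → 2 ≤ ℓ j → X ≤ ℓ j → Walk (onCycle j X) centre (cycleDist (ℓ j) X)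
  walk-to-centre j {X} 2≤ℓ X≤ℓ with ⊓-sel X (ℓ j ∸ X)
  ... | inj₁ e = subst (Walk (onCycle j X) centre) (sym e)
                   (subst (λ Y → Walk (onCycle j Y) centre X) (+-identityʳ X)
                     (onCycle-walk-down j X 0 2≤ℓ (subst (_≤ ℓ j) (sym (+-identityʳ X)) X≤ℓ)))
  ... | inj₂ e = subst (Walk (onCycle j X) centre) (sym e)
                   (subst (λ v → Walk (onCycle j X) v (ℓ j ∸ X)) (onCycle-end j (m∸n+n≡m X≤ℓ))
                     (onCycle-walk-up j (ℓ j ∸ X) X 2≤ℓ (≤-reflexive (m∸n+n≡m X≤ℓ))))

  via-centre : ∀ j i {Y X} → 2 ≤ ℓ j → 2 ≤ ℓ i → Y ≤ ℓ j → X ≤ ℓ i →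
               Walk (onCycle j Y) (onCycle i X) (cycleDist (ℓ j) Y + cycleDist (ℓ i) X)
  via-centre j i 2≤ℓj 2≤ℓi Y≤ℓ X≤ℓ = walk-to-centre j 2≤ℓj Y≤ℓ ++ʷ centre-walk i 2≤ℓi X≤ℓ

module Tour {r : ℕ} (H : Fin r → ℕ) (3≤H : ∀ j → 3 ≤ H j) (A B : Fin r) (H≤H-B : ∀ j → H j ≤ H B) where

  ℓ : Fin r → ℕ
  ℓ j = suc (H j + H j)

  open Game (BAdj ℓ)
  open Bouquet ℓ
  open OddCycle

  2≤ℓ : ∀ j → 2 ≤ ℓ j
  2≤ℓ j = s≤s (≤-trans (s≤s z≤n) (≤-trans (3≤H j) (m≤m+n (H j) (H j))))

  ≤H⇒<ℓ : ∀ j {a} → a ≤ H j → a < ℓ j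
  ≤H⇒<ℓ j a≤H = s≤s (≤-trans a≤H (m≤m+n (H j) (H j)))

  -- The survivor stands at position `at` of cycle `cur`; `prev` is the cycle it toured before.
  record State : Set where
    constructor state
    field
      prev cur : Fin r
      at       : ℕ

  advance : State → State
  advance (state P C X) with suc X <? ℓ C
  ... | yes _ = state P C (suc X)
  ... | no  _ = state C B 0

  advance^ : ℕ → State → State
  advance^ zero    σ = σ
  advance^ (suc n) σ = advance^ n (advance σ)

  location : State → BVert ℓ
  location (state P C X) = onCycle C X

  behind : State → ℕ → BVert ℓ
  behind (state P C X) g with g ≤? X
  ... | yes _ = onCycle C (X ∸ g)
  ... | no  _ = onCycle P (ℓ P ∸ (g ∸ X))

  behind-≤ : ∀ P C X g → g ≤ X → behind (state P C X) g ≡ onCycle C (X ∸ g)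
  behind-≤ P C X g g≤X with g ≤? X
  ... | yes _   = refl
  ... | no  g≰X = ⊥-elim (g≰X g≤X)

  behind-> : ∀ P C X g → X < g → behind (state P C X) g ≡ onCycle P (ℓ P ∸ (g ∸ X))
  behind-> P C X g X<g with g ≤? X
  ... | yes g≤X = ⊥-elim (<-irrefl refl (<-≤-trans X<g g≤X))
  ... | no  _   = refl

  advance-< : ∀ P C X → suc X < ℓ C → advance (state P C X) ≡ state P C (suc X)
  advance-< P C X 1+X<ℓ with suc X <? ℓ C
  ... | yes _    = refl
  ... | no  1+X≮ = ⊥-elim (1+X≮ 1+X<ℓ)

  advance-end : ∀ P C X → suc X ≡ ℓ C → advance (state P C X) ≡ state C B 0
  advance-end P C X 1+X≡ℓ with suc X <? ℓ C
  ... | yes 1+X<ℓ = ⊥-elim (<-irrefl 1+X≡ℓ 1+X<ℓ)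
  ... | no  _     = refl

  advance-cases : ∀ P C X → X < ℓ C →
                  (suc X < ℓ C × advance (state P C X) ≡ state P C (suc X)) ⊎
                  (suc X ≡ ℓ C × advance (state P C X) ≡ state C B 0)
  advance-cases P C X X<ℓ with m≤n⇒m<n∨m≡n X<ℓ
  ... | inj₁ 1+X<ℓ = inj₁ (1+X<ℓ , advance-< P C X 1+X<ℓ)
  ... | inj₂ 1+X≡ℓ = inj₂ (1+X≡ℓ , advance-end P C X 1+X≡ℓ)

  OnRoute : Fin r → Set
  OnRoute j = j ≡ A ⊎ j ≡ B

  WellFormed : State → Set
  WellFormed (state P C X) = X < ℓ C × OnRoute C × OnRoute P

  advance-wellFormed : ∀ σ → WellFormed σ → WellFormed (advance σ)
  advance-wellFormed (state P C X) (X<ℓ , C-on , P-on) with advance-cases P C X X<ℓ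
  ... | inj₁ (1+X<ℓ , e) rewrite e = 1+X<ℓ , C-on , P-on
  ... | inj₂ (_     , e) rewrite e = s≤s z≤n , inj₂ refl , C-on

  advance-adj : ∀ σ → WellFormed σ → BAdj ℓ (location σ) (location (advance σ))
  advance-adj (state P C X) (X<ℓ , _) with advance-cases P C X X<ℓ
  ... | inj₁ (_     , e) rewrite e = onCycle-adj C X (2≤ℓ C) X<ℓ
  ... | inj₂ (1+X≡ℓ , e) rewrite e =
    subst (BAdj ℓ (onCycle C X)) (onCycle-end C 1+X≡ℓ) (onCycle-adj C X (2≤ℓ C) X<ℓ)

  Gap : State → ℕ → Set
  Gap (state P C X) g = 2 ≤ g × g < H C × (g ≤ X ⊎ g < H P)

  gap-advance : ∀ σ g → WellFormed σ → Gap σ g → Gap (advance σ) g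
  gap-advance (state P C X) g (X<ℓ , C-on , _) (2≤g , g<H , reach) with advance-cases P C X X<ℓ
  ... | inj₁ (_ , e) rewrite e = 2≤g , g<H , Data.Sum.map₁ (λ g≤X → ≤-trans g≤X (n≤1+n X)) reach
  ... | inj₂ (_ , e) rewrite e = 2≤g , <-≤-trans g<H (H≤H-B C) , inj₂ g<H

  behind-advance : ∀ σ g → WellFormed σ → g < ℓ (State.cur σ) → behind (advance σ) (suc g) ≡ behind σ g
  behind-advance (state P C X) g (X<ℓ , _) g<ℓ with advance-cases P C X X<ℓ
  ... | inj₁ (_ , e) rewrite e with g ≤? X
  ...   | yes g≤X = behind-≤ P C (suc X) (suc g) (s≤s g≤X)
  ...   | no  g≰X = behind-> P C (suc X) (suc g) (s≤s (≰⇒> g≰X))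
  behind-advance (state P C X) g (X<ℓ , _) g<ℓ | inj₂ (1+X≡ℓ , e) rewrite e = begin
    behind (state C B 0) (suc g)  ≡⟨ behind-> C B 0 (suc g) (s≤s z≤n) ⟩
    onCycle C (ℓ C ∸ suc g)       ≡⟨ cong (λ L → onCycle C (L ∸ suc g)) (sym 1+X≡ℓ) ⟩
    onCycle C (X ∸ g)             ≡⟨ sym (behind-≤ P C X g (≤-pred (subst (suc g ≤_) (sym 1+X≡ℓ) g<ℓ))) ⟩
    behind (state P C X) g        ∎
    where open ≡-Reasoning

  behind-adj : ∀ P C X h → X < ℓ C → (suc h ≤ X ⊎ suc h ≤ H P) →
               BAdj ℓ (behind (state P C X) (suc h)) (behind (state P C X) h)
  behind-adj P C X h X<ℓ reach with ≤-<-connex (suc h) X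
  ... | inj₁ 1+h≤X rewrite behind-≤ P C X (suc h) 1+h≤X | behind-≤ P C X h (≤-trans (n≤1+n h) 1+h≤X) =
    subst (λ Y → BAdj ℓ (onCycle C (X ∸ suc h)) (onCycle C Y)) (sym (+-∸-assoc 1 1+h≤X))
      (onCycle-adj C (X ∸ suc h) (2≤ℓ C)
                   (subst (_≤ ℓ C) (+-∸-assoc 1 1+h≤X) (≤-trans (m∸n≤m X h) (<⇒≤ X<ℓ))))
  ... | inj₂ X<1+h with ≤-<-connex h X
  ...   | inj₁ h≤X rewrite behind-> P C X (suc h) X<1+h | behind-≤ P C X h h≤X | ≤-antisym h≤X (≤-pred X<1+h)
                         | +-∸-assoc 1 {X} ≤-refl | n∸n≡0 X =
    subst (BAdj ℓ (onCycle P (H P + H P))) (onCycle-end P refl) (onCycle-adj P (H P + H P) (2≤ℓ P) ≤-refl)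
  ...   | inj₂ X<h rewrite behind-> P C X (suc h) X<1+h | behind-> P C X h X<h | +-∸-assoc 1 (<⇒≤ X<h) =
    subst (λ Y → BAdj ℓ (onCycle P (ℓ P ∸ suc (h ∸ X))) (onCycle P Y)) (sym (+-∸-assoc 1 h∸X<ℓ))
      (onCycle-adj P (ℓ P ∸ suc (h ∸ X)) (2≤ℓ P)
                   (subst (_≤ ℓ P) (+-∸-assoc 1 h∸X<ℓ) (m∸n≤m (ℓ P) (h ∸ X))))
    where
    1+h≤H : suc h ≤ H P
    1+h≤H = <-excludes-≥ X<1+h reach
    h∸X<ℓ : h ∸ X < ℓ P
    h∸X<ℓ = ≤H⇒<ℓ P (≤-trans (m∸n≤m h X) (≤-trans (n≤1+n h) 1+h≤H))

  behind-walk : ∀ P C X h → X < ℓ C → (h ≤ X ⊎ h ≤ H P) → Walk (behind (state P C X) h) (onCycle C X) h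
  behind-walk P C X zero    _   _     = subst (λ v → Walk v (onCycle C X) 0) (sym (behind-≤ P C X 0 z≤n)) here
  behind-walk P C X (suc h) X<ℓ reach =
    step (behind-adj P C X h X<ℓ reach)
         (behind-walk P C X h X<ℓ (Data.Sum.map (≤-trans (n≤1+n h)) (≤-trans (n≤1+n h)) reach))

  dist-behind : ∀ P C X h → X < ℓ C → h ≤ H C → (h ≤ X ⊎ h ≤ H P) →
                dist (behind (state P C X) h) (onCycle C X) ≡ h
  dist-behind P C X h X<ℓ h≤H reach with ≤-<-connex h X
  ... | inj₁ h≤X rewrite behind-≤ P C X h h≤X = begin
    dist (onCycle C (X ∸ h)) (onCycle C X)
      ≡⟨ dist-onCycle C (X ∸ h) X (≤-trans (m∸n≤m X h) (<⇒≤ X<ℓ)) (<⇒≤ X<ℓ) ⟩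
    cycleDist (ℓ C) ∣ X ∸ h - X ∣
      ≡⟨ cong (cycleDist (ℓ C)) (trans (m≤n⇒∣m-n∣≡n∸m (m∸n≤m X h)) (m∸[m∸n]≡n h≤X)) ⟩
    cycleDist (ℓ C) h
      ≡⟨ cycleDist-≤half (H C) h≤H ⟩
    h ∎
    where open ≡-Reasoning
  ... | inj₂ X<h rewrite behind-> P C X h X<h with P ≟ C
  ...   | yes refl = begin
    dist (onCycle P (ℓ P ∸ (h ∸ X))) (onCycle P X)
      ≡⟨ dist-onCycle P (ℓ P ∸ (h ∸ X)) X (m∸n≤m (ℓ P) (h ∸ X)) (<⇒≤ X<ℓ) ⟩
    cycleDist (ℓ P) ∣ ℓ P ∸ (h ∸ X) - X ∣
      ≡⟨ cong (λ Y → cycleDist (ℓ P) ∣ Y - X ∣) (m∸[n∸o]≡m∸n+o (<⇒≤ X<h) (<⇒≤ (≤H⇒<ℓ P h≤H))) ⟩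
    cycleDist (ℓ P) ∣ ℓ P ∸ h + X - X ∣
      ≡⟨ cong (cycleDist (ℓ P)) (trans (m≤n⇒∣n-m∣≡n∸m (m≤n+m X (ℓ P ∸ h))) (m+n∸n≡m (ℓ P ∸ h) X)) ⟩
    cycleDist (ℓ P) (ℓ P ∸ h)
      ≡⟨ cycleDist-reflect-≤half (H P) h≤H ⟩
    h ∎
    where open ≡-Reasoning
  ...   | no P≢C = begin
    dist (onCycle P (ℓ P ∸ (h ∸ X))) (onCycle C X)
      ≡⟨ dist-onCycle-≢ P≢C (ℓ P ∸ (h ∸ X)) X (m∸n≤m (ℓ P) (h ∸ X)) (<⇒≤ X<ℓ) ⟩
    cycleDist (ℓ P) (ℓ P ∸ (h ∸ X)) + cycleDist (ℓ C) X
      ≡⟨ cong₂ _+_ (cycleDist-reflect-≤half (H P) (≤-trans (m∸n≤m h X) (<-excludes-≥ X<h reach)))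
                   (cycleDist-≤half (H C) (≤-trans (<⇒≤ X<h) h≤H)) ⟩
    h ∸ X + X
      ≡⟨ m∸n+n≡m (<⇒≤ X<h) ⟩
    h ∎
    where open ≡-Reasoning

  behind-neighbours-on-cur : ∀ P C X g {w} → X < ℓ C → suc g < X →
                             BAdj ℓ (behind (state P C X) (suc g)) w →
                             w ≡ behind (state P C X) g ⊎ w ≡ behind (state P C X) (suc (suc g))
  behind-neighbours-on-cur P C X g {w} X<ℓ 1+g<X adj
    with onCycle-neighbours C (m<n⇒0<n∸m 1+g<X) (≤-<-trans (m∸n≤m X (suc g)) X<ℓ)
                            (subst (λ v → BAdj ℓ v w) (behind-≤ P C X (suc g) (<⇒≤ 1+g<X)) adj)
  ... | inj₁ e = inj₂ (trans e (trans (cong (onCycle C) (pred[m∸n]≡m∸[1+n] X (suc g)))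
                                      (sym (behind-≤ P C X (suc (suc g)) 1+g<X))))
  ... | inj₂ e = inj₁ (trans e (trans (cong (onCycle C) (sym (+-∸-assoc 1 (<⇒≤ 1+g<X))))
                                      (sym (behind-≤ P C X g (≤-trans (n≤1+n g) (<⇒≤ 1+g<X))))))

  forward-on-prev : ∀ P C X g → X < suc g → suc g ∸ X < ℓ P →
                    onCycle P (suc (ℓ P ∸ (suc g ∸ X))) ≡ behind (state P C X) g
  forward-on-prev P C X g X<1+g a<ℓ with ≤-<-connex g X
  ... | inj₁ g≤X rewrite ≤-antisym (≤-pred X<1+g) g≤X | +-∸-assoc 1 {g} ≤-refl | n∸n≡0 g =
    trans (onCycle-end P refl) (sym (trans (behind-≤ P C g g ≤-refl) (cong (onCycle C) (n∸n≡0 g))))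
  ... | inj₂ X<g = begin
    onCycle P (suc (ℓ P ∸ (suc g ∸ X)))
      ≡⟨ cong (λ b → onCycle P (suc (ℓ P ∸ b))) (+-∸-assoc 1 (<⇒≤ X<g)) ⟩
    onCycle P (suc (ℓ P ∸ suc (g ∸ X)))
      ≡⟨ cong (onCycle P) (sym (+-∸-assoc 1 (≤-<-trans (∸-monoˡ-≤ X (n≤1+n g)) a<ℓ))) ⟩
    onCycle P (ℓ P ∸ (g ∸ X))
      ≡⟨ sym (behind-> P C X g X<g) ⟩
    behind (state P C X) g ∎
    where open ≡-Reasoning

  behind-neighbours-on-prev : ∀ P C X g {w} → X < suc g → suc g ∸ X < ℓ P →
                              BAdj ℓ (behind (state P C X) (suc g)) w →
                              w ≡ behind (state P C X) g ⊎ w ≡ behind (state P C X) (suc (suc g))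
  behind-neighbours-on-prev P C X g {w} X<1+g a<ℓ adj
    with onCycle-neighbours P (m<n⇒0<n∸m a<ℓ) (∸-monoʳ-< (m<n⇒0<n∸m X<1+g) (<⇒≤ a<ℓ))
                            (subst (λ v → BAdj ℓ v w) (behind-> P C X (suc g) X<1+g) adj)
  ... | inj₁ e = inj₂ (trans e (trans (cong (onCycle P) (trans (pred[m∸n]≡m∸[1+n] (ℓ P) (suc g ∸ X))
                                                              (cong (ℓ P ∸_) (sym (+-∸-assoc 1 (<⇒≤ X<1+g))))))
                                      (sym (behind-> P C X (suc (suc g)) (≤-trans X<1+g (n≤1+n _))))))
  ... | inj₂ e = inj₁ (trans e (forward-on-prev P C X g X<1+g a<ℓ))

  behind-neighbours-off-centre : ∀ P C X g {w} → X < ℓ C → suc g ≢ X → (suc g ≤ X ⊎ suc g < H P) →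
                                 BAdj ℓ (behind (state P C X) (suc g)) w →
                                 w ≡ behind (state P C X) g ⊎ w ≡ behind (state P C X) (suc (suc g))
  behind-neighbours-off-centre P C X g X<ℓ 1+g≢X reach with ≤-<-connex (suc g) X
  ... | inj₁ 1+g≤X = behind-neighbours-on-cur P C X g X<ℓ (≤∧≢⇒< 1+g≤X 1+g≢X)
  ... | inj₂ X<1+g = behind-neighbours-on-prev P C X g X<1+g
                       (≤H⇒<ℓ P (≤-trans (m∸n≤m (suc g) X) (<⇒≤ (<-excludes-≥ X<1+g reach))))

  dist-other-cycle : ∀ {j C} Y X → j ≢ C → Y ≤ ℓ j → X ≤ H C → X ≤ dist (onCycle j Y) (onCycle C X)
  dist-other-cycle {j} {C} Y X j≢C Y≤ℓ X≤H
    rewrite dist-onCycle-≢ j≢C Y X Y≤ℓ (<⇒≤ (≤H⇒<ℓ C X≤H)) | cycleDist-≤half (H C) X≤H = m≤n+m X _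

  dist-last : ∀ C X → X < H C → dist (onCycle C (ℓ C ∸ 1)) (onCycle C X) ≡ suc X
  dist-last C X X<H = begin
    dist (onCycle C (H C + H C)) (onCycle C X)
      ≡⟨ dist-onCycle C (H C + H C) X (n≤1+n _) (<⇒≤ (≤H⇒<ℓ C (<⇒≤ X<H))) ⟩
    cycleDist (ℓ C) ∣ H C + H C - X ∣
      ≡⟨ cong (cycleDist (ℓ C)) (m≤n⇒∣n-m∣≡n∸m (≤-pred (≤H⇒<ℓ C (<⇒≤ X<H)))) ⟩
    cycleDist (ℓ C) (ℓ C ∸ suc X)
      ≡⟨ cycleDist-reflect-≤half (H C) X<H ⟩
    suc X ∎
    where open ≡-Reasoning

  centre-neighbour-far : ∀ C X {w} → X < H C → BAdj ℓ centre w → w ≡ onCycle C 1 ⊎ X ≤ dist w (onCycle C X)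
  centre-neighbour-far C X X<H adj with centre-neighbours adj
  ... | j , side with j ≟ C | side
  ...   | yes refl | inj₁ e    = inj₁ e
  ...   | yes refl | inj₂ refl = inj₂ (≤-trans (n≤1+n X) (≤-reflexive (sym (dist-last j X X<H))))
  ...   | no  j≢C  | inj₁ refl = inj₂ (dist-other-cycle 1 X j≢C (<⇒≤ (2≤ℓ j)) (<⇒≤ X<H))
  ...   | no  j≢C  | inj₂ refl = inj₂ (dist-other-cycle (ℓ j ∸ 1) X j≢C (m∸n≤m (ℓ j) 1) (<⇒≤ X<H))

  trail-neighbours : ∀ P C X g {w} → X < ℓ C → Gap (state P C X) (suc g) →
                     BAdj ℓ (behind (state P C X) (suc g)) w →
                     w ≡ behind (state P C X) g ⊎ suc g ≤ dist w (onCycle C X)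
  trail-neighbours P C X g {w} X<ℓ (_ , 1+g<H , reach) adj with suc g ≟ℕ X
  ... | yes refl = Data.Sum.map₁ (λ e → trans e (sym (trans (behind-≤ P C (suc g) g (n≤1+n g))
                                                             (cong (onCycle C) (m+n∸n≡m 1 g)))))
                     (centre-neighbour-far C (suc g) 1+g<H (subst (λ v → BAdj ℓ v w) at-centre adj))
    where
    at-centre : behind (state P C (suc g)) (suc g) ≡ centre
    at-centre = trans (behind-≤ P C (suc g) (suc g) ≤-refl) (cong (onCycle C) (n∸n≡0 g))
  ... | no 1+g≢X with behind-neighbours-off-centre P C X g X<ℓ 1+g≢X reach adj
  ...   | inj₁ e    = inj₁ e
  ...   | inj₂ refl = inj₂ (≤-trans (n≤1+n _) (≤-reflexive (sym (dist-behind P C X (suc (suc g)) X<ℓ 1+g<H reach′))))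
    where
    reach′ : suc (suc g) ≤ X ⊎ suc (suc g) ≤ H P
    reach′ = Data.Sum.map₁ (λ 1+g≤X → ≤∧≢⇒< 1+g≤X 1+g≢X) reach

  trailing-step : ∀ σ g {z z'} → WellFormed σ → Gap σ g → z ≡ behind σ g → ZombieStep (location σ) z z' →
                  z' ≢ location σ × z' ≡ behind (advance σ) g
  trailing-step (state P C X) zero    _ (() , _) _ _
  trailing-step (state P C X) (suc g) {z' = z'} wf@(X<ℓ , _) gap@(2≤1+g , 1+g<H , reach) refl zstep =
    subst (_≢ onCycle C X) (sym z'≡)
          (dist-pos⇒≢ (subst (1 ≤_) (sym (dist-behind P C X g X<ℓ g≤H reach′)) (≤-pred 2≤1+g))) ,
    trans z'≡ (sym (behind-advance (state P C X) g wf (≤H⇒<ℓ C g≤H)))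
    where
    g≤H : g ≤ H C
    g≤H = ≤-trans (n≤1+n g) (<⇒≤ 1+g<H)
    reach′ : g ≤ X ⊎ g ≤ H P
    reach′ = Data.Sum.map (≤-trans (n≤1+n g)) (λ 1+g<HP → ≤-trans (n≤1+n g) (<⇒≤ 1+g<HP)) reach
    z'≡ : z' ≡ behind (state P C X) g
    z'≡ = zombieStep-forced-by-dist (behind-walk P C X (suc g) X<ℓ (Data.Sum.map₂ <⇒≤ reach))
                                    (λ w → trail-neighbours P C X g X<ℓ gap) zstep

  FirstHalf : State → Set
  FirstHalf (state P C X) = 2 ≤ X × X < H C

  Trailing : BVert ℓ → State → Set
  Trailing z σ = Σ ℕ λ g → Gap σ g × z ≡ behind σ g

  -- The zombie will reach the centre exactly when the survivor is in the first half of a cycle.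
  Approaching : BVert ℓ → State → Set
  Approaching z σ = Σ (Fin r) λ j → Σ ℕ λ p →
    j ≢ A × j ≢ B × 1 ≤ p × p < ℓ j × z ≡ onCycle j p × FirstHalf (advance^ (cycleDist (ℓ j) p) σ)

  Harmless : BVert ℓ → State → Set
  Harmless z σ = Trailing z σ ⊎ Approaching z σ

  off-route-≢ : ∀ {j C} → j ≢ A → j ≢ B → OnRoute C → j ≢ C
  off-route-≢ j≢A j≢B (inj₁ refl) = j≢A
  off-route-≢ j≢A j≢B (inj₂ refl) = j≢B

  centre-trailing : ∀ σ → FirstHalf σ → Trailing centre σ
  centre-trailing (state P C X) (2≤X , X<H) =
    X , (2≤X , X<H , inj₁ ≤-refl) , sym (trans (behind-≤ P C X X ≤-refl) (cong (onCycle C) (n∸n≡0 X)))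

  other-cycle-apart : ∀ {j C} p X → j ≢ C → 1 ≤ p → p < ℓ j → X < ℓ C → onCycle j p ≢ onCycle C X
  other-cycle-apart {j} p X j≢C 1≤p p<ℓ X<ℓ =
    dist-pos⇒≢ (subst (1 ≤_) (sym (dist-onCycle-≢ j≢C p X (<⇒≤ p<ℓ) (<⇒≤ X<ℓ)))
                              (≤-trans (cycleDist-pos (ℓ j) 1≤p p<ℓ) (m≤m+n _ _)))

  reach-centre : ∀ σ → WellFormed σ → FirstHalf (advance σ) → centre ≢ location σ × Harmless centre (advance σ)
  reach-centre (state P C X) (X<ℓ , _) first-half with advance-cases P C X X<ℓ
  ... | inj₁ (_ , e) =
    dist-pos⇒≢ (subst (1 ≤_) (sym (dist-onCycle C 0 X z≤n (<⇒≤ X<ℓ))) (cycleDist-pos (ℓ C) 1≤X X<ℓ)) ,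
    inj₁ (centre-trailing _ first-half)
    where
    1≤X : 1 ≤ X
    1≤X = ≤-pred (proj₁ (subst FirstHalf e first-half))
  ... | inj₂ (_ , e) with subst FirstHalf e first-half
  ...   | () , _

  keep-approaching : ∀ σ j p → WellFormed σ → j ≢ A → j ≢ B → 1 ≤ p → p < ℓ j →
                     FirstHalf (advance^ (cycleDist (ℓ j) p) (advance σ)) →
                     onCycle j p ≢ location σ × Harmless (onCycle j p) (advance σ)
  keep-approaching (state P C X) j p (X<ℓ , C-on , _) j≢A j≢B 1≤p p<ℓ first-half =
    other-cycle-apart p X (off-route-≢ j≢A j≢B C-on) 1≤p p<ℓ X<ℓ ,
    inj₂ (j , p , j≢A , j≢B , 1≤p , p<ℓ , refl , first-half)

  step-inward : ∀ j p C X {z'} → j ≢ C → suc p ≤ H j → X < ℓ C →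
                ZombieStep (onCycle C X) (onCycle j (suc p)) z' → z' ≡ onCycle j p
  step-inward j p C X j≢C 1+p≤H X<ℓ = zombieStep-forced-by-dist route others
    where
    p<ℓ : suc p < ℓ j
    p<ℓ = ≤H⇒<ℓ j 1+p≤H
    route : Walk (onCycle j (suc p)) (onCycle C X) (cycleDist (ℓ j) (suc p) + cycleDist (ℓ C) X)
    route = via-centre j C (2≤ℓ j) (2≤ℓ C) (<⇒≤ p<ℓ) (<⇒≤ X<ℓ)
    others : ∀ w → BAdj ℓ (onCycle j (suc p)) w →
             w ≡ onCycle j p ⊎ cycleDist (ℓ j) (suc p) + cycleDist (ℓ C) X ≤ dist w (onCycle C X)
    others w adj with onCycle-neighbours j (s≤s z≤n) p<ℓ adj
    ... | inj₁ e    = inj₁ e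
    ... | inj₂ refl rewrite dist-onCycle-≢ j≢C (suc (suc p)) X p<ℓ (<⇒≤ X<ℓ) | cycleDist-≤half (H j) 1+p≤H =
      inj₂ (+-monoˡ-≤ _ (≤half⇒≤cycleDist-suc (H j) 1+p≤H))

  step-outward : ∀ j p C X {z'} → j ≢ C → H j < suc p → suc p < ℓ j → X < ℓ C →
                 ZombieStep (onCycle C X) (onCycle j (suc p)) z' → z' ≡ onCycle j (suc (suc p))
  step-outward j p C X j≢C H<1+p p<ℓ X<ℓ = zombieStep-forced-by-dist route others
    where
    route : Walk (onCycle j (suc p)) (onCycle C X) (cycleDist (ℓ j) (suc p) + cycleDist (ℓ C) X)
    route = via-centre j C (2≤ℓ j) (2≤ℓ C) (<⇒≤ p<ℓ) (<⇒≤ X<ℓ)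
    others : ∀ w → BAdj ℓ (onCycle j (suc p)) w →
             w ≡ onCycle j (suc (suc p)) ⊎ cycleDist (ℓ j) (suc p) + cycleDist (ℓ C) X ≤ dist w (onCycle C X)
    others w adj with onCycle-neighbours j (s≤s z≤n) p<ℓ adj
    ... | inj₂ e    = inj₁ e
    ... | inj₁ refl rewrite dist-onCycle-≢ j≢C p X (≤-trans (n≤1+n p) (<⇒≤ p<ℓ)) (<⇒≤ X<ℓ)
                          | cycleDist->half (H j) H<1+p (<⇒≤ p<ℓ) =
      inj₂ (+-monoˡ-≤ _ (>half⇒≤cycleDist-pred (H j) H<1+p))

  closer-to-centre : ∀ j p C X {z'} → j ≢ C → 1 ≤ p → p < ℓ j → X < ℓ C →
                     ZombieStep (onCycle C X) (onCycle j p) z' →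
                     Σ ℕ λ p' → p' ≤ ℓ j × z' ≡ onCycle j p' × cycleDist (ℓ j) p ≡ suc (cycleDist (ℓ j) p')
  closer-to-centre j (suc p) C X j≢C _ p<ℓ X<ℓ zstep with suc p ≤? H j
  ... | yes 1+p≤H =
    p , ≤-trans (n≤1+n p) (<⇒≤ p<ℓ) , step-inward j p C X j≢C 1+p≤H X<ℓ zstep ,
    trans (cycleDist-≤half (H j) 1+p≤H) (cong suc (sym (cycleDist-≤half (H j) (≤-trans (n≤1+n p) 1+p≤H))))
  ... | no  1+p≰H =
    suc (suc p) , p<ℓ , step-outward j p C X j≢C H<1+p p<ℓ X<ℓ zstep ,
    trans (cycleDist->half (H j) H<1+p (<⇒≤ p<ℓ))
          (trans (+-∸-assoc 1 p<ℓ) (cong suc (sym (cycleDist->half (H j) (≤-trans H<1+p (n≤1+n _)) p<ℓ))))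
    where
    H<1+p : H j < suc p
    H<1+p = ≰⇒> 1+p≰H

  approaching-step : ∀ σ {z z'} → WellFormed σ → Approaching z σ → ZombieStep (location σ) z z' →
                     z' ≢ location σ × Harmless z' (advance σ)
  approaching-step (state P C X) wf@(X<ℓ , C-on , _) (j , p , j≢A , j≢B , 1≤p , p<ℓ , refl , first-half) zstep
    with closer-to-centre j p C X (off-route-≢ j≢A j≢B C-on) 1≤p p<ℓ X<ℓ zstep
  ... | p' , p'≤ℓ , refl , closer with onCycle-view j p' p'≤ℓ
  ...   | inj₁ (e , end) rewrite e =
    reach-centre (state P C X) wf
      (subst (λ n → FirstHalf (advance^ n (state P C X))) (trans closer (cong suc (cycleDist-end (ℓ j) end))) first-half)
  ...   | inj₂ (q , _ , refl) =
    keep-approaching (state P C X) j (suc (toℕ q)) wf j≢A j≢B (s≤s z≤n) (suc-toℕ< (ℓ j) q)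
      (subst (λ n → FirstHalf (advance^ n (state P C X))) closer first-half)

  harmless-step : ∀ σ {z z'} → WellFormed σ → Harmless z σ → ZombieStep (location σ) z z' →
                  z' ≢ location σ × Harmless z' (advance σ)
  harmless-step σ wf (inj₁ (g , gap , z≡)) zstep with trailing-step σ g wf gap z≡ zstep
  ... | apart , z'≡ = apart , inj₁ (g , gap-advance σ g wf gap , z'≡)
  harmless-step σ wf (inj₂ approaching) zstep = approaching-step σ wf approaching zstep

  harmless-apart : ∀ σ {z} → WellFormed σ → Harmless z σ → z ≢ location σ
  harmless-apart (state P C X) (X<ℓ , _) (inj₁ (g , (2≤g , g<H , reach) , refl)) =
    dist-pos⇒≢ (subst (1 ≤_) (sym (dist-behind P C X g X<ℓ (<⇒≤ g<H) (Data.Sum.map₂ <⇒≤ reach)))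
                              (≤-trans (s≤s z≤n) 2≤g))
  harmless-apart (state P C X) (X<ℓ , C-on , _) (inj₂ (j , p , j≢A , j≢B , 1≤p , p<ℓ , refl , _)) =
    other-cycle-apart p X (off-route-≢ j≢A j≢B C-on) 1≤p p<ℓ X<ℓ

  open GameProperties.Evasion (BAdj ℓ) location advance WellFormed Harmless
         (λ {σ} → advance-wellFormed σ) (λ {σ} → advance-adj σ)
         (λ {_} {σ} → harmless-apart σ) (λ {_} {_} {σ} → harmless-step σ)
    public

  advance^-+ : ∀ m n σ → advance^ (m + n) σ ≡ advance^ n (advance^ m σ)
  advance^-+ zero    n σ = refl
  advance^-+ (suc m) n σ = advance^-+ m n (advance σ)

  advance^-along : ∀ n P C X → n + X < ℓ C → advance^ n (state P C X) ≡ state P C (n + X)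
  advance^-along zero    P C X _   = refl
  advance^-along (suc n) P C X n+1+X<ℓ rewrite advance-< P C X (≤-<-trans (s≤s (m≤n+m X n)) n+1+X<ℓ) =
    trans (advance^-along n P C (suc X) (subst (_< ℓ C) (sym (+-suc n X)) n+1+X<ℓ)) (cong (state P C) (+-suc n X))

  advance^-onto-B : ∀ P C u → u < ℓ B → advance^ (ℓ C + u) (state P C 0) ≡ state C B u
  advance^-onto-B P C u u<ℓ = begin
    advance^ (ℓ C + u) (state P C 0)
      ≡⟨ cong (λ n → advance^ n (state P C 0)) (sym (+-suc (H C + H C) u)) ⟩
    advance^ (H C + H C + suc u) (state P C 0)
      ≡⟨ advance^-+ (H C + H C) (suc u) (state P C 0) ⟩
    advance^ (suc u) (advance^ (H C + H C) (state P C 0))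
      ≡⟨ cong (advance^ (suc u)) (advance^-along (H C + H C) P C 0 last<ℓ) ⟩
    advance^ u (advance (state P C (H C + H C + 0)))
      ≡⟨ cong (advance^ u) (advance-end P C _ (cong suc (+-identityʳ _))) ⟩
    advance^ u (state C B 0)
      ≡⟨ advance^-along u C B 0 (subst (_< ℓ B) (sym (+-identityʳ u)) u<ℓ) ⟩
    state C B (u + 0)
      ≡⟨ cong (state C B) (+-identityʳ u) ⟩
    state C B u ∎
    where
    open ≡-Reasoning
    last<ℓ : H C + H C + 0 < ℓ C
    last<ℓ = s≤s (≤-reflexive (+-identityʳ _))

  start : State
  start = state A A 2

  2<ℓ : 2 < ℓ A
  2<ℓ = ≤H⇒<ℓ A (≤-trans (n≤1+n 2) (3≤H A))

  start-wellFormed : WellFormed start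
  start-wellFormed = 2<ℓ , inj₁ refl , inj₁ refl

  start-onto-B : ∀ d u → ℓ A + u ≡ 2 + d → u < ℓ B → advance^ d start ≡ state A B u
  start-onto-B d u ℓ+u≡2+d u<ℓ = begin
    advance^ d start                        ≡⟨ cong (advance^ d) (sym (advance^-along 2 A A 0 2<ℓ)) ⟩
    advance^ d (advance^ 2 (state A A 0))   ≡⟨ sym (advance^-+ 2 d (state A A 0)) ⟩
    advance^ (2 + d) (state A A 0)          ≡⟨ cong (λ n → advance^ n (state A A 0)) (sym ℓ+u≡2+d) ⟩
    advance^ (ℓ A + u) (state A A 0)        ≡⟨ advance^-onto-B A A u u<ℓ ⟩
    state A B u                             ∎
    where open ≡-Reasoning

  start-first-half : ∀ d → d ≤ H B → d + 3 ≤ H A ⊎ ℓ A ≤ d → FirstHalf (advance^ d start)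
  start-first-half d _ (inj₁ d+3≤H) =
    subst FirstHalf (sym (advance^-along d A A 2 (≤H⇒<ℓ A (<⇒≤ d+2<H)))) (m≤n+m 2 d , d+2<H)
    where
    d+2<H : d + 2 < H A
    d+2<H = subst (_≤ H A) (+-suc d 2) d+3≤H
  start-first-half d d≤H (inj₂ ℓ≤d) with m≤n⇒∃[o]m+o≡n (≤-trans ℓ≤d (m≤n+m d 2))
  ... | u , ℓ+u≡2+d = subst FirstHalf (sym (start-onto-B d u ℓ+u≡2+d (≤H⇒<ℓ B (<⇒≤ u<H)))) (2≤u , u<H)
    where
    2≤u : 2 ≤ u
    2≤u = +-cancelˡ-≤ (ℓ A) 2 u (subst (ℓ A + 2 ≤_) (sym ℓ+u≡2+d)
                                       (subst (_≤ 2 + d) (+-comm 2 (ℓ A)) (+-monoʳ-≤ 2 ℓ≤d)))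
    u<H : u < H B
    u<H = +-cancelˡ-≤ 2 (suc u) (H B)
                      (≤-trans (+-monoˡ-≤ u 2<ℓ) (≤-trans (≤-reflexive ℓ+u≡2+d) (+-monoʳ-≤ 2 d≤H)))

  initially-harmless : ∀ z → (∀ {j q} → z ≡ pt j q → j ≢ A × j ≢ B) →
                       dist z centre + 3 ≤ H A ⊎ ℓ A ≤ dist z centre → Harmless z start
  initially-harmless centre   _   _      = inj₁ (centre-trailing start (≤-refl , 3≤H A))
  initially-harmless (pt j q) off window =
    inj₂ (j , suc (toℕ q) , proj₁ (off refl) , proj₂ (off refl) , s≤s z≤n , suc-toℕ< (ℓ j) q ,
          sym (onCycle-pt j q) ,
          start-first-half _ (≤-trans (cycleDist-≤-H (H j) _) (H≤H-B j)) window)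

scale : ℕ → ℕ
scale a = 3 ^ suc a

3≤scale : ∀ a → 3 ≤ scale a
3≤scale a = *-monoʳ-≤ 3 (m^n>0 3 a)

scale-gap : ∀ {a b} → a < b → scale a + scale a + 3 ≤ scale b
scale-gap {a} {b} a<b = begin
  scale a + scale a + 3        ≤⟨ +-monoʳ-≤ (scale a + scale a) (3≤scale a) ⟩
  scale a + scale a + scale a  ≡⟨ trans (+-assoc (scale a) _ _)
                                        (cong (λ x → scale a + (scale a + x)) (sym (+-identityʳ _))) ⟩
  3 * scale a                  ≤⟨ ^-monoʳ-≤ 3 {suc (suc a)} {suc b} (s≤s a<b) ⟩
  scale b                      ∎
  where open ≤-Reasoning

InWindow : ℕ → ℕ → Set
InWindow h d = h ≤ d + 2 × d ≤ h + h

inWindow? : ∀ h d → Dec (InWindow h d)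
inWindow? h d = (h ≤? d + 2) ×-dec (d ≤? h + h)

windows-disjoint : ∀ {a b d} → a < b → InWindow (scale a) d → InWindow (scale b) d → ⊥
windows-disjoint {a} a<b (_ , d≤2a) (b≤d+2 , _) =
  1+n≰n (+-cancelˡ-≤ (scale a + scale a) 3 2 (≤-trans (scale-gap a<b) (≤-trans b≤d+2 (+-monoˡ-≤ 2 d≤2a))))

outside-window : ∀ h d → ¬ InWindow h d → d + 3 ≤ h ⊎ suc (h + h) ≤ d
outside-window h d outside with h ≤? d + 2
... | yes h≤d+2 = inj₂ (≰⇒> (λ d≤2h → outside (h≤d+2 , d≤2h)))
... | no  h≰d+2 = inj₁ (≤-trans (≤-reflexive (+-suc d 2)) (≰⇒> h≰d+2))

module Construction (k : ℕ) where

  -- Cycle combine c a is copy c of class a; the k + 1 classes have half-lengths scale 0, …, scale k.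
  r : ℕ
  r = suc k * suc k

  class : Fin r → Fin (suc k)
  class i = proj₂ (remQuot {suc k} (suc k) i)

  H : Fin r → ℕ
  H i = scale (toℕ (class i))

  ℓ : Fin r → ℕ
  ℓ i = suc (H i + H i)

  3≤ℓ : ∀ i → 3 ≤ ℓ i
  3≤ℓ i = s≤s (≤-trans (n≤1+n 2) (≤-trans (3≤scale (toℕ (class i))) (m≤m+n _ _)))

  class-combine : ∀ (c a : Fin (suc k)) → class (combine c a) ≡ a
  class-combine c a = cong proj₂ (remQuot-combine {suc k} {suc k} c a)

  H≤top : ∀ (c : Fin (suc k)) j → H j ≤ H (combine c (fromℕ k))
  H≤top c j rewrite class-combine c (fromℕ k) | toℕ-fromℕ k = ^-monoʳ-≤ 3 (s≤s (≤-pred (toℕ<n (class j))))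

  lies-on : BVert ℓ → Fin r → Set
  lies-on centre   _ = ⊥
  lies-on (pt j _) x = j ≡ x

  lies-on? : ∀ z x → Dec (lies-on z x)
  lies-on? centre   _ = no λ ()
  lies-on? (pt j _) x = j ≟ x

  free-copy : ∀ {m} → m < suc k → (zs : Fin m → BVert ℓ) → (a : Fin (suc k)) →
              Σ (Fin (suc k)) λ c → ∀ i → ¬ lies-on (zs i) (combine c a)
  free-copy {m} m<k zs a = free-slot m<k (λ c i → lies-on (zs i) (combine c a)) (λ c i → lies-on? (zs i) _) unique
    where
    unique : ∀ {c c' i} → lies-on (zs i) (combine c a) → lies-on (zs i) (combine c' a) → c ≡ c'
    unique {c} {c'} {i} on on' with zs i
    ... | pt j _ = combine-injectiveˡ c a c' a (trans (sym on) on')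

  quiet-class : ∀ {m} → m < suc k → (d : Fin m → ℕ) →
                Σ (Fin (suc k)) λ a → ∀ i → ¬ InWindow (scale (toℕ a)) (d i)
  quiet-class m<k d =
    free-slot m<k (λ a i → InWindow (scale (toℕ a)) (d i)) (λ a i → inWindow? (scale (toℕ a)) (d i)) unique
    where
    unique : ∀ {a a' i} → InWindow (scale (toℕ a)) (d i) → InWindow (scale (toℕ a')) (d i) → a ≡ a'
    unique {a} {a'} w w' with <-cmp (toℕ a) (toℕ a')
    ... | tri< a<a' _ _ = ⊥-elim (windows-disjoint a<a' w w')
    ... | tri≈ _ a≡a' _ = toℕ-injective a≡a'
    ... | tri> _ _ a'<a = ⊥-elim (windows-disjoint a'<a w' w)

  zombie-number : Game.ZombieNumber≥ (BAdj ℓ) (suc k)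
  zombie-number m m<1+k (zs , win) = T.survivor-evades T.start-wellFormed harmless (win (T.location T.start))
    where
    distance : Fin m → ℕ
    distance i = Bouquet.dist ℓ (zs i) centre
    a : Fin (suc k)
    a = proj₁ (quiet-class m<1+k distance)
    copy-A : Σ (Fin (suc k)) λ c → ∀ i → ¬ lies-on (zs i) (combine c a)
    copy-A = free-copy m<1+k zs a
    copy-B : Σ (Fin (suc k)) λ c → ∀ i → ¬ lies-on (zs i) (combine c (fromℕ k))
    copy-B = free-copy m<1+k zs (fromℕ k)
    A B : Fin r
    A = combine (proj₁ copy-A) a
    B = combine (proj₁ copy-B) (fromℕ k)
    module T = Tour H (λ j → 3≤scale (toℕ (class j))) A B (H≤top (proj₁ copy-B))
    off-route : ∀ i {j q} → zs i ≡ pt j q → j ≢ A × j ≢ B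
    off-route i e = (λ j≡A → proj₂ copy-A i (subst (λ z → lies-on z A) (sym e) j≡A))
                  , (λ j≡B → proj₂ copy-B i (subst (λ z → lies-on z B) (sym e) j≡B))
    H-A : scale (toℕ a) ≡ H A
    H-A = cong (scale ∘ toℕ) (sym (class-combine (proj₁ copy-A) a))
    harmless : ∀ i → T.Harmless (zs i) T.start
    harmless i = T.initially-harmless (zs i) (off-route i)
                   (subst (λ h → distance i + 3 ≤ h ⊎ suc (h + h) ≤ distance i) H-A
                     (outside-window _ _ (proj₂ (quiet-class m<1+k distance) i)))

theorem2 : ∀ (k : ℕ) → 1 ≤ k →
  Σ ℕ λ r → Σ (Fin r → ℕ) λ ℓ →
    (∀ i → 3 ≤ ℓ i) × Game.ZombieNumber≥ (BAdj ℓ) k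
theorem2 (suc k) _ = r , ℓ , 3≤ℓ , zombie-number
  where open Construction k
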